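{- For all terms $t,t',t''$: if $t$ is reducible by $\to_{R_2,ACh}$ and $t''\approx_{AC}t+t'$, then $t''$ is also reducible by $\to_{R_2,ACh}$.
   Context: Terms are over $\{+,h,0\}$, variables and free constants. $R_2$ is the rewrite system $x+x\to0$, $x+0\to x$, $x+(y+x)\to y$, $h(0)\to0$. $ACh$ is the theory generated by associativity and commutativity of $+$ and $h(x+y)\approx h(x)+h(y)$; $AC$ is associativity and commutativity of $+$. $t\to_{R_2,ACh}t'$ iff there are a non-variable position $p$ of $t$, a rule $l\to r\in R_2$ and a substitution $\sigma$ with $t|_p=_{ACh}l\sigma$ and $t'=t[r\sigma]_p$. -}

module Defs where

open import Data.Nat using (ℕ)
open import Data.Product using (Σ; ∃; _×_)
open import Relation.Binary.PropositionalEquality using (_≡_)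
import Data.Empty

infixl 6 _⊕_
data Term : Set where
  var  : ℕ → Term
  cst  : ℕ → Term
  𝟘    : Term
  _⊕_  : Term → Term → Term
  h    : Term → Term

Subst : Set
Subst = ℕ → Term

_·_ : Term → Subst → Term
var x   · σ = σ x
cst c   · σ = cst c
𝟘       · σ = 𝟘
(s ⊕ t) · σ = (s · σ) ⊕ (t · σ)
h t     · σ = h (t · σ)

data EqTh (Ax : Term → Term → Set) : Term → Term → Set where
  ax     : ∀ {s t} → Ax s t → EqTh Ax s t
  refl≈  : ∀ {t} → EqTh Ax t t
  sym≈   : ∀ {s t} → EqTh Ax s t → EqTh Ax t s
  trans≈ : ∀ {s t u} → EqTh Ax s t → EqTh Ax t u → EqTh Ax s u
  cong⊕  : ∀ {s s' t t'} → EqTh Ax s s' → EqTh Ax t t' → EqTh Ax (s ⊕ t) (s' ⊕ t')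
  congh  : ∀ {s s'} → EqTh Ax s s' → EqTh Ax (h s) (h s')

data AC-ax : Term → Term → Set where
  assoc : ∀ x y z → AC-ax ((x ⊕ y) ⊕ z) (x ⊕ (y ⊕ z))
  comm  : ∀ x y → AC-ax (x ⊕ y) (y ⊕ x)

data ACh-ax : Term → Term → Set where
  assoc : ∀ x y z → ACh-ax ((x ⊕ y) ⊕ z) (x ⊕ (y ⊕ z))
  comm  : ∀ x y → ACh-ax (x ⊕ y) (y ⊕ x)
  hom   : ∀ x y → ACh-ax (h (x ⊕ y)) (h x ⊕ h y)

_≈AC_ : Term → Term → Set
s ≈AC t = EqTh AC-ax s t

_≈ACh_ : Term → Term → Set
s ≈ACh t = EqTh ACh-ax s t

-- The rewrite system R₂ (x = var 0, y = var 1).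
data R₂ : Term → Term → Set where
  r1 : R₂ (var 0 ⊕ var 0) 𝟘
  r2 : R₂ (var 0 ⊕ 𝟘) (var 0)
  r3 : R₂ (var 0 ⊕ (var 1 ⊕ var 0)) (var 1)
  r4 : R₂ (h 𝟘) 𝟘

-- One-hole contexts (= positions in a term); t = C[t|_p].
data Ctx : Set where
  □    : Ctx
  _⊕ₗ_ : Ctx → Term → Ctx
  _⊕ᵣ_ : Term → Ctx → Ctx
  hᶜ   : Ctx → Ctx

_[_] : Ctx → Term → Term
□        [ s ] = s
(C ⊕ₗ t) [ s ] = (C [ s ]) ⊕ t
(t ⊕ᵣ C) [ s ] = t ⊕ (C [ s ])
hᶜ C     [ s ] = h (C [ s ])

IsVar : Term → Set
IsVar t = ∃ λ x → t ≡ var x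

data _⟶_ (t t' : Term) : Set where
  step : (C : Ctx) (s : Term) → t ≡ C [ s ] → (IsVar s → Data.Empty.⊥)
       → ∀ {l r} → R₂ l r → (σ : Subst) → s ≈ACh (l · σ) → t' ≡ C [ r · σ ]
       → t ⟶ t'

Reducible : Term → Set
Reducible t = ∃ λ t' → t ⟶ t'

-- A redex can only be destroyed by an AC-step if the step cuts it off from its
-- surroundings, i.e. if it is the left summand x + y of (x + y) + z (or, up to
-- commutativity, the right one).  For R₂ this never happens: every root instance
-- of x + x, x + 0 or x + (y + x) extends to a root instance of a left-hand side
-- after adding a summand z, while h(0) is not ACh-equal to any sum.  Hence
-- reducibility is invariant under ≈AC, and t + t' is reducible whenever t is.
module Submission where

open import Defs
open import Data.Product using (_,_)
open import Function.Bundles using (_⇔_; mk⇔; Equivalence)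
open import Function.Properties.Equivalence using (⇔-isEquivalence)
open import Relation.Nullary using (¬_)
open import Relation.Binary.Bundles using (Setoid)
open import Relation.Binary.Structures using (IsEquivalence)
open import Level using (0ℓ)
open import Relation.Binary.PropositionalEquality as ≡ using (_≡_)
import Relation.Binary.Reasoning.Setoid as SetoidReasoning

module ⇔ = IsEquivalence (⇔-isEquivalence {ℓ = 0ℓ})

≈AC⇒≈ACh : ∀ {s t} → s ≈AC t → s ≈ACh t
≈AC⇒≈ACh (ax (assoc x y z)) = ax (assoc x y z)
≈AC⇒≈ACh (ax (comm x y))    = ax (comm x y)
≈AC⇒≈ACh refl≈              = refl≈
≈AC⇒≈ACh (sym≈ p)           = sym≈ (≈AC⇒≈ACh p)
≈AC⇒≈ACh (trans≈ p q)       = trans≈ (≈AC⇒≈ACh p) (≈AC⇒≈ACh q)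
≈AC⇒≈ACh (cong⊕ p q)        = cong⊕ (≈AC⇒≈ACh p) (≈AC⇒≈ACh q)
≈AC⇒≈ACh (congh p)          = congh (≈AC⇒≈ACh p)

ACh-setoid : Setoid 0ℓ 0ℓ
ACh-setoid = record
  { Carrier       = Term
  ; _≈_           = _≈ACh_
  ; isEquivalence = record { refl = refl≈ ; sym = sym≈ ; trans = trans≈ }
  }

-- The ACh-classes of 𝟘 and h 𝟘 are singletons; shape tells them apart from the rest.
data Shape : Set where
  zero-shape h-zero-shape other-shape : Shape

h-shape : Shape → Shape
h-shape zero-shape = h-zero-shape
h-shape _          = other-shape

shape : Term → Shape
shape 𝟘     = zero-shape
shape (h t) = h-shape (shape t)
shape _     = other-shape

shape-resp-≈ACh : ∀ {s t} → s ≈ACh t → shape s ≡ shape t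
shape-resp-≈ACh (ax (assoc x y z)) = ≡.refl
shape-resp-≈ACh (ax (comm x y))    = ≡.refl
shape-resp-≈ACh (ax (hom x y))     = ≡.refl
shape-resp-≈ACh refl≈              = ≡.refl
shape-resp-≈ACh (sym≈ p)           = ≡.sym (shape-resp-≈ACh p)
shape-resp-≈ACh (trans≈ p q)       = ≡.trans (shape-resp-≈ACh p) (shape-resp-≈ACh q)
shape-resp-≈ACh (cong⊕ p q)        = ≡.refl
shape-resp-≈ACh (congh p)          = ≡.cong h-shape (shape-resp-≈ACh p)

⊕≉ACh-h𝟘 : ∀ {a b} → ¬ (a ⊕ b) ≈ACh h 𝟘
⊕≉ACh-h𝟘 e with shape-resp-≈ACh e
... | ()

data Matches (t : Term) : Set where
  match : ∀ {l r} → R₂ l r → (σ : Subst) → t ≈ACh (l · σ) → Matches t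

Matches-resp-≈ACh : ∀ {s t} → s ≈ACh t → Matches t → Matches s
Matches-resp-≈ACh e (match ρ σ m) = match ρ σ (trans≈ e m)

x↦_y↦_ : Term → Term → Subst
(x↦ a y↦ b) 0 = a
(x↦ a y↦ b) _ = b

Matches-⊕ʳ : ∀ {a b} → Matches (a ⊕ b) → ∀ c → Matches ((a ⊕ b) ⊕ c)
Matches-⊕ʳ {a} {b} (match r1 σ m) c = match r3 (x↦ σ 0 y↦ c) (begin
  (a ⊕ b) ⊕ c             ≈⟨ cong⊕ m refl≈ ⟩
  (σ 0 ⊕ σ 0) ⊕ c         ≈⟨ ax (assoc _ _ _) ⟩
  σ 0 ⊕ (σ 0 ⊕ c)         ≈⟨ cong⊕ refl≈ (ax (comm _ _)) ⟩
  σ 0 ⊕ (c ⊕ σ 0)         ∎)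
  where open SetoidReasoning ACh-setoid
Matches-⊕ʳ {a} {b} (match r2 σ m) c = match r2 (x↦ (σ 0 ⊕ c) y↦ c) (begin
  (a ⊕ b) ⊕ c             ≈⟨ cong⊕ m refl≈ ⟩
  (σ 0 ⊕ 𝟘) ⊕ c           ≈⟨ ax (assoc _ _ _) ⟩
  σ 0 ⊕ (𝟘 ⊕ c)           ≈⟨ cong⊕ refl≈ (ax (comm _ _)) ⟩
  σ 0 ⊕ (c ⊕ 𝟘)           ≈⟨ sym≈ (ax (assoc _ _ _)) ⟩
  (σ 0 ⊕ c) ⊕ 𝟘           ∎)
  where open SetoidReasoning ACh-setoid
Matches-⊕ʳ {a} {b} (match r3 σ m) c = match r3 (x↦ σ 0 y↦ (σ 1 ⊕ c)) (begin
  (a ⊕ b) ⊕ c             ≈⟨ cong⊕ m refl≈ ⟩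
  (σ 0 ⊕ (σ 1 ⊕ σ 0)) ⊕ c ≈⟨ ax (assoc _ _ _) ⟩
  σ 0 ⊕ ((σ 1 ⊕ σ 0) ⊕ c) ≈⟨ cong⊕ refl≈ (ax (assoc _ _ _)) ⟩
  σ 0 ⊕ (σ 1 ⊕ (σ 0 ⊕ c)) ≈⟨ cong⊕ refl≈ (cong⊕ refl≈ (ax (comm _ _))) ⟩
  σ 0 ⊕ (σ 1 ⊕ (c ⊕ σ 0)) ≈⟨ cong⊕ refl≈ (sym≈ (ax (assoc _ _ _))) ⟩
  σ 0 ⊕ ((σ 1 ⊕ c) ⊕ σ 0) ∎)
  where open SetoidReasoning ACh-setoid
Matches-⊕ʳ (match r4 σ m) c with () ← ⊕≉ACh-h𝟘 m

data HasRedex : Term → Set where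
  root : ∀ {t} → ¬ IsVar t → Matches t → HasRedex t
  ⊕ˡ   : ∀ {a b} → HasRedex a → HasRedex (a ⊕ b)
  ⊕ʳ   : ∀ {a b} → HasRedex b → HasRedex (a ⊕ b)
  h↓   : ∀ {a} → HasRedex a → HasRedex (h a)

root⊕ : ∀ {a b} → Matches (a ⊕ b) → HasRedex (a ⊕ b)
root⊕ = root λ { (_ , ()) }

HasRedex-plug : ∀ C {s} → HasRedex s → HasRedex (C [ s ])
HasRedex-plug □        r = r
HasRedex-plug (C ⊕ₗ t) r = ⊕ˡ (HasRedex-plug C r)
HasRedex-plug (t ⊕ᵣ C) r = ⊕ʳ (HasRedex-plug C r)
HasRedex-plug (hᶜ C)   r = h↓ (HasRedex-plug C r)

Reducible-⊕ˡ : ∀ {a} b → Reducible a → Reducible (a ⊕ b)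
Reducible-⊕ˡ b (_ , step C s ≡.refl nv ρ σ m ≡.refl) = _ , step (C ⊕ₗ b) s ≡.refl nv ρ σ m ≡.refl

Reducible-⊕ʳ : ∀ a {b} → Reducible b → Reducible (a ⊕ b)
Reducible-⊕ʳ a (_ , step C s ≡.refl nv ρ σ m ≡.refl) = _ , step (a ⊕ᵣ C) s ≡.refl nv ρ σ m ≡.refl

Reducible-h : ∀ {a} → Reducible a → Reducible (h a)
Reducible-h (_ , step C s ≡.refl nv ρ σ m ≡.refl) = _ , step (hᶜ C) s ≡.refl nv ρ σ m ≡.refl

Reducible⇔HasRedex : ∀ {t} → Reducible t ⇔ HasRedex t
Reducible⇔HasRedex = mk⇔ to from
  where
  to : ∀ {t} → Reducible t → HasRedex t
  to (_ , step C s ≡.refl nv ρ σ m _) = HasRedex-plug C (root nv (match ρ σ m))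
  from : ∀ {t} → HasRedex t → Reducible t
  from (root nv (match ρ σ m)) = _ , step □ _ ≡.refl nv ρ σ m ≡.refl
  from (⊕ˡ r) = Reducible-⊕ˡ _ (from r)
  from (⊕ʳ r) = Reducible-⊕ʳ _ (from r)
  from (h↓ r) = Reducible-h (from r)

HasRedex-assoc : ∀ x y z → HasRedex ((x ⊕ y) ⊕ z) ⇔ HasRedex (x ⊕ (y ⊕ z))
HasRedex-assoc x y z = mk⇔ to from
  where
  to : HasRedex ((x ⊕ y) ⊕ z) → HasRedex (x ⊕ (y ⊕ z))
  to (root _ m)      = root⊕ (Matches-resp-≈ACh (sym≈ (ax (assoc x y z))) m)
  to (⊕ˡ (root _ m)) = to (root⊕ (Matches-⊕ʳ m z))
  to (⊕ˡ (⊕ˡ r))     = ⊕ˡ r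
  to (⊕ˡ (⊕ʳ r))     = ⊕ʳ (⊕ˡ r)
  to (⊕ʳ r)          = ⊕ʳ (⊕ʳ r)
  from : HasRedex (x ⊕ (y ⊕ z)) → HasRedex ((x ⊕ y) ⊕ z)
  from (root _ m)      = root⊕ (Matches-resp-≈ACh (ax (assoc x y z)) m)
  from (⊕ˡ r)          = ⊕ˡ (⊕ˡ r)
  from (⊕ʳ (root _ m)) = from (root⊕ (Matches-resp-≈ACh (ax (comm x (y ⊕ z))) (Matches-⊕ʳ m x)))
  from (⊕ʳ (⊕ˡ r))     = ⊕ˡ (⊕ʳ r)
  from (⊕ʳ (⊕ʳ r))     = ⊕ʳ r

HasRedex-comm : ∀ x y → HasRedex (x ⊕ y) → HasRedex (y ⊕ x)
HasRedex-comm x y (root _ m) = root⊕ (Matches-resp-≈ACh (ax (comm y x)) m)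
HasRedex-comm x y (⊕ˡ r)     = ⊕ʳ r
HasRedex-comm x y (⊕ʳ r)     = ⊕ˡ r

HasRedex-cong⊕ : ∀ {a a′ b b′} → (HasRedex a → HasRedex a′) → (HasRedex b → HasRedex b′)
               → (a′ ⊕ b′) ≈ACh (a ⊕ b) → HasRedex (a ⊕ b) → HasRedex (a′ ⊕ b′)
HasRedex-cong⊕ f g e (root _ m) = root⊕ (Matches-resp-≈ACh e m)
HasRedex-cong⊕ f g e (⊕ˡ r)     = ⊕ˡ (f r)
HasRedex-cong⊕ f g e (⊕ʳ r)     = ⊕ʳ (g r)

HasRedex-congh : ∀ {a a′} → (HasRedex a → HasRedex a′)
               → h a′ ≈ACh h a → HasRedex (h a) → HasRedex (h a′)
HasRedex-congh f e (root _ m) = root (λ { (_ , ()) }) (Matches-resp-≈ACh e m)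
HasRedex-congh f e (h↓ r)     = h↓ (f r)

HasRedex-resp-≈AC : ∀ {s t} → s ≈AC t → HasRedex s ⇔ HasRedex t
HasRedex-resp-≈AC (ax (assoc x y z)) = HasRedex-assoc x y z
HasRedex-resp-≈AC (ax (comm x y))    = mk⇔ (HasRedex-comm x y) (HasRedex-comm y x)
HasRedex-resp-≈AC refl≈              = ⇔.refl
HasRedex-resp-≈AC (sym≈ p)           = ⇔.sym (HasRedex-resp-≈AC p)
HasRedex-resp-≈AC (trans≈ p q)       = ⇔.trans (HasRedex-resp-≈AC p) (HasRedex-resp-≈AC q)
HasRedex-resp-≈AC (cong⊕ p q)        = mk⇔
  (HasRedex-cong⊕ (to (HasRedex-resp-≈AC p)) (to (HasRedex-resp-≈AC q)) (≈AC⇒≈ACh (sym≈ (cong⊕ p q))))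
  (HasRedex-cong⊕ (from (HasRedex-resp-≈AC p)) (from (HasRedex-resp-≈AC q)) (≈AC⇒≈ACh (cong⊕ p q)))
  where open Equivalence
HasRedex-resp-≈AC (congh p)          = mk⇔
  (HasRedex-congh (to (HasRedex-resp-≈AC p)) (≈AC⇒≈ACh (sym≈ (congh p))))
  (HasRedex-congh (from (HasRedex-resp-≈AC p)) (≈AC⇒≈ACh (congh p)))
  where open Equivalence

Reducible-resp-≈AC : ∀ {s t} → s ≈AC t → Reducible s → Reducible t
Reducible-resp-≈AC e r = from Reducible⇔HasRedex (to (HasRedex-resp-≈AC e) (to Reducible⇔HasRedex r))
  where open Equivalence

mainTheorem17 : ∀ (t t' t'' : Term) → Reducible t → t'' ≈AC (t ⊕ t') → Reducible t''
mainTheorem17 t t' t'' r e = Reducible-resp-≈AC (sym≈ e) (Reducible-⊕ˡ t' r)
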